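{- None of the frame properties seriality, reflexivity, transitivity, symmetry and Euclidicity is definable in $\mathcal{L}(\boxdot)\cup\mathcal{L}(\boxplus)$: for each such property $P$ there is no set $\Gamma$ of formulas of $\mathcal{L}(\boxdot)$, and no set $\Gamma$ of formulas of $\mathcal{L}(\boxplus)$, such that for every bimodal frame $\mathcal{F}$, $\mathcal{F}$ has $P$ iff $\mathcal{F}\vDash\Gamma$.
   Context: Fix a nonempty set $\mathbf{P}$ of propositional variables. $\mathcal{L}(\boxdot)$ is given by $\phi::=p\mid\neg\phi\mid(\phi\land\phi)\mid\boxdot\phi$ and $\mathcal{L}(\boxplus)$ by $\phi::=p\mid\neg\phi\mid(\phi\land\phi)\mid\boxplus\phi$, with $p\in\mathbf{P}$. A bimodal frame is $\langle S,R_1,R_2\rangle$ with $S$ nonempty and $R_1,R_2\subseteq S\times S$; a bimodal model adds a valuation $V:\mathbf{P}\to\mathcal{P}(S)$; $R_i(s)=\{t\mid sR_it\}$. Semantics: Boolean clauses as usual; $\mathcal{M},s\vDash\boxdot\phi$ iff for all $t,u$ with $sR_1t$ and $sR_2u$, $(\mathcal{M},t\vDash\phi\iff\mathcal{M},u\vDash\phi)$; $\mathcal{M},s\vDash\boxplus\phi$ iff either all $t\in R_1(s)$ satisfy $\phi$ or all $u\in R_2(s)$ satisfy $\neg\phi$. $\mathcal{F}\vDash\Gamma$ means every formula of $\Gamma$ is true at every point of every model based on $\mathcal{F}$. A bimodal frame has one of the listed properties if both $R_1$ and $R_2$ have it. -}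

module Defs where

open import Data.Product using (Σ; ∃; _×_; _,_)
open import Data.Empty using (⊥)
open import Data.Sum using (_⊎_)
open import Relation.Nullary using (¬_)
open import Function.Bundles using (_⇔_)
open import Level using (Level; suc; _⊔_) renaming (zero to lzero)

data Fm⊡ (P : Set) : Set where
  var  : P → Fm⊡ P
  neg  : Fm⊡ P → Fm⊡ P
  conj : Fm⊡ P → Fm⊡ P → Fm⊡ P
  dot  : Fm⊡ P → Fm⊡ P

data Fm⊞ (P : Set) : Set where
  var  : P → Fm⊞ P
  neg  : Fm⊞ P → Fm⊞ P
  conj : Fm⊞ P → Fm⊞ P → Fm⊞ P
  plus : Fm⊞ P → Fm⊞ P

record Frame : Set₁ where
  field
    S   : Set
    pt  : S              -- witness of nonemptiness
    R₁  : S → S → Set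
    R₂  : S → S → Set

Valuation : Set → Frame → Set₁
Valuation P F = P → Frame.S F → Set

sat⊡ : {P : Set} (F : Frame) → Valuation P F → Frame.S F → Fm⊡ P → Set
sat⊡ F V s (var p)    = V p s
sat⊡ F V s (neg φ)    = ¬ sat⊡ F V s φ
sat⊡ F V s (conj φ ψ) = sat⊡ F V s φ × sat⊡ F V s ψ
sat⊡ F V s (dot φ)    = ∀ t u → Frame.R₁ F s t → Frame.R₂ F s u →
                          (sat⊡ F V t φ ⇔ sat⊡ F V u φ)

sat⊞ : {P : Set} (F : Frame) → Valuation P F → Frame.S F → Fm⊞ P → Set
sat⊞ F V s (var p)    = V p s
sat⊞ F V s (neg φ)    = ¬ sat⊞ F V s φ
sat⊞ F V s (conj φ ψ) = sat⊞ F V s φ × sat⊞ F V s ψ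
sat⊞ F V s (plus φ)   = (∀ t → Frame.R₁ F s t → sat⊞ F V t φ)
                        ⊎ (∀ u → Frame.R₂ F s u → ¬ sat⊞ F V u φ)

_⊨⊡_ : {P : Set} → Frame → (Fm⊡ P → Set) → Set₁
_⊨⊡_ {P} F Γ = ∀ (V : Valuation P F) (s : Frame.S F) (φ : Fm⊡ P) → Γ φ → sat⊡ F V s φ

_⊨⊞_ : {P : Set} → Frame → (Fm⊞ P → Set) → Set₁
_⊨⊞_ {P} F Γ = ∀ (V : Valuation P F) (s : Frame.S F) (φ : Fm⊞ P) → Γ φ → sat⊞ F V s φ

module _ {S : Set} (R : S → S → Set) where
  Serial Reflexive Transitive Symmetric Euclidean : Set
  Serial     = ∀ s → ∃ λ t → R s t
  Reflexive  = ∀ s → R s s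
  Transitive = ∀ s t u → R s t → R t u → R s u
  Symmetric  = ∀ s t → R s t → R t s
  Euclidean  = ∀ s t u → R s t → R s u → R t u

data FrameProperty : Set where
  seriality reflexivity transitivity symmetry euclidicity : FrameProperty

relHas : FrameProperty → {S : Set} → (S → S → Set) → Set
relHas seriality    R = Serial R
relHas reflexivity  R = Reflexive R
relHas transitivity R = Transitive R
relHas symmetry     R = Symmetric R
relHas euclidicity  R = Euclidean R

Has : FrameProperty → Frame → Set
Has Pr F = relHas Pr (Frame.R₁ F) × relHas Pr (Frame.R₂ F)

Defines⊡ : {P : Set} → FrameProperty → (Fm⊡ P → Set) → Set₁
Defines⊡ Pr Γ = ∀ (F : Frame) → Has Pr F ⇔ (F ⊨⊡ Γ)

Defines⊞ : {P : Set} → FrameProperty → (Fm⊞ P → Set) → Set₁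
Defines⊞ Pr Γ = ∀ (F : Frame) → Has Pr F ⇔ (F ⊨⊞ Γ)

-- Call ⊡ (resp. ⊞) trivial on a frame when every formula ⊡ψ (resp.
-- ⊞ψ) is true at every point under every valuation.  If two frames on the
-- same carrier both trivialise the modality, no formula can tell them apart:
-- truth is decided by the valuation and the Boolean connectives alone.
-- Constructively, ⊞ψ can in general only be shown irrefutable (¬¬-true) on
-- the first frame, so the transfer lemma proves "true on F ⇒ true on G" and
-- "true on G ⇒ ¬¬ true on F" by one mutual induction.  Hence validity of Γ
-- passes from F to G, and a property that F has but G lacks is undefinable.
--
-- Every frame whose second relation is empty trivialises both modalities.
-- Two separating pairs then cover all five properties:
--   * seriality, reflexivity: the one-point frame with both relations total
--     versus the one-point frame with both relations empty;
--   * transitivity, symmetry, Euclidicity: the three-point frame with both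
--     relations empty versus the chain a → b → c (second relation empty).
module Submission where

open import Defs
open import Data.Product using (Σ; _×_; _,_; proj₂)
open import Data.Empty using (⊥)
open import Data.Unit using (⊤; tt)
open import Data.Sum using (inj₁; inj₂)
open import Relation.Nullary using (¬_)
open import Function.Base using (id)
open import Function.Bundles using (Equivalence; mk⇔)

frame : (S : Set) → S → (S → S → Set) → (S → S → Set) → Frame
frame S pt R₁ R₂ = record { S = S ; pt = pt ; R₁ = R₁ ; R₂ = R₂ }

noEdge : {S : Set} → S → S → Set
noEdge _ _ = ⊥

DotHolds DotIrrefutable PlusHolds PlusIrrefutable : Frame → Set₁
DotHolds F        = ∀ {P} (V : Valuation P F) s ψ → sat⊡ F V s (dot ψ)
DotIrrefutable F  = ∀ {P} (V : Valuation P F) s ψ → ¬ ¬ sat⊡ F V s (dot ψ)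
PlusHolds F       = ∀ {P} (V : Valuation P F) s ψ → sat⊞ F V s (plus ψ)
PlusIrrefutable F = ∀ {P} (V : Valuation P F) s ψ → ¬ ¬ sat⊞ F V s (plus ψ)

dotHolds⇒irrefutable : ∀ {F} → DotHolds F → DotIrrefutable F
dotHolds⇒irrefutable holds V s ψ ¬dot = ¬dot (holds V s ψ)

plusHolds⇒irrefutable : ∀ {F} → PlusHolds F → PlusIrrefutable F
plusHolds⇒irrefutable holds V s ψ ¬plus = ¬plus (holds V s ψ)

-- With an empty second relation, ⊡ψ holds vacuously (no u with sR₂u) and
-- ⊞ψ holds by its second disjunct.
dotHolds-noEdge : ∀ {S pt R₁} → DotHolds (frame S pt R₁ noEdge)
dotHolds-noEdge V s ψ t u _ ()

plusHolds-noEdge : ∀ {S pt R₁} → PlusHolds (frame S pt R₁ noEdge)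
plusHolds-noEdge V s ψ = inj₂ (λ u ())

module Transfer {S : Set} {pt : S} {A₁ A₂ B₁ B₂ : S → S → Set} where

  private
    F G : Frame
    F = frame S pt A₁ A₂
    G = frame S pt B₁ B₂

  module ForDot (irrefutableF : DotIrrefutable F) (holdsG : DotHolds G) where

    mutual
      forth : ∀ {P} (V : P → S → Set) s φ → sat⊡ F V s φ → sat⊡ G V s φ
      forth V s (var p)    v         = v
      forth V s (neg φ)    ¬φ φG     = back V s φ φG ¬φ
      forth V s (conj φ ψ) (φF , ψF) = forth V s φ φF , forth V s ψ ψF
      forth V s (dot φ)    _         = holdsG V s φ

      back : ∀ {P} (V : P → S → Set) s φ → sat⊡ G V s φ → ¬ ¬ sat⊡ F V s φ
      back V s (var p)    v         k = k v
      back V s (neg φ)    ¬φ        k = k (λ φF → ¬φ (forth V s φ φF))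
      back V s (conj φ ψ) (φG , ψG) k =
        back V s φ φG (λ φF → back V s ψ ψG (λ ψF → k (φF , ψF)))
      back V s (dot φ)    _         = irrefutableF V s φ

    validity : ∀ {P} (Γ : Fm⊡ P → Set) → F ⊨⊡ Γ → G ⊨⊡ Γ
    validity Γ validF V s φ γ = forth V s φ (validF V s φ γ)

  module ForPlus (irrefutableF : PlusIrrefutable F) (holdsG : PlusHolds G) where

    mutual
      forth : ∀ {P} (V : P → S → Set) s φ → sat⊞ F V s φ → sat⊞ G V s φ
      forth V s (var p)    v         = v
      forth V s (neg φ)    ¬φ φG     = back V s φ φG ¬φ
      forth V s (conj φ ψ) (φF , ψF) = forth V s φ φF , forth V s ψ ψF
      forth V s (plus φ)   _         = holdsG V s φ

      back : ∀ {P} (V : P → S → Set) s φ → sat⊞ G V s φ → ¬ ¬ sat⊞ F V s φ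
      back V s (var p)    v         k = k v
      back V s (neg φ)    ¬φ        k = k (λ φF → ¬φ (forth V s φ φF))
      back V s (conj φ ψ) (φG , ψG) k =
        back V s φ φG (λ φF → back V s ψ ψG (λ ψF → k (φF , ψF)))
      back V s (plus φ)   _         = irrefutableF V s φ

    validity : ∀ {P} (Γ : Fm⊞ P → Set) → F ⊨⊞ Γ → G ⊨⊞ Γ
    validity Γ validF V s φ γ = forth V s φ (validF V s φ γ)

record Separation (Pr : FrameProperty) : Set₁ where
  field
    S          : Set
    pt         : S
    A₁ A₂ B₁   : S → S → Set
    hasF       : Has Pr (frame S pt A₁ A₂)
    lacksG     : ¬ Has Pr (frame S pt B₁ noEdge)
    dotF       : DotIrrefutable (frame S pt A₁ A₂)
    plusF      : PlusIrrefutable (frame S pt A₁ A₂)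

-- A separating pair refutes definability in both languages: a defining Γ
-- would be valid on F, hence on G, forcing G to have the property.
undefinable : ∀ {P : Set} {Pr} → Separation Pr →
  (¬ Σ (Fm⊡ P → Set) (λ Γ → Defines⊡ Pr Γ)) × (¬ Σ (Fm⊞ P → Set) (λ Γ → Defines⊞ Pr Γ))
undefinable sep =
  (λ (Γ , defines) → lacksG (Equivalence.from (defines G)
     (Transfer.ForDot.validity dotF dotHolds-noEdge Γ (Equivalence.to (defines F) hasF)))) ,
  (λ (Γ , defines) → lacksG (Equivalence.from (defines G)
     (Transfer.ForPlus.validity plusF plusHolds-noEdge Γ (Equivalence.to (defines F) hasF))))
  where
    open Separation sep
    F G : Frame
    F = frame S pt A₁ A₂
    G = frame S pt B₁ noEdge

total : ⊤ → ⊤ → Set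
total _ _ = ⊤

loop : Frame
loop = frame ⊤ tt total total

-- On the loop, ⊡ψ compares the only point with itself, and ⊞ψ reduces to
-- ψ ∨ ¬ψ at that point, which is irrefutable.
dotHolds-loop : DotHolds loop
dotHolds-loop V s ψ tt tt _ _ = mk⇔ id id

plusIrrefutable-loop : PlusIrrefutable loop
plusIrrefutable-loop V s ψ ¬plus =
  ¬plus (inj₂ (λ { tt _ ψtt → ¬plus (inj₁ (λ { tt _ → ψtt })) }))

viaLoop : ∀ {Pr} → Has Pr loop → ¬ Has Pr (frame ⊤ tt noEdge noEdge) → Separation Pr
viaLoop hasLoop lacksPoint = record
  { S = ⊤ ; pt = tt ; A₁ = total ; A₂ = total ; B₁ = noEdge
  ; hasF = hasLoop ; lacksG = lacksPoint
  ; dotF = dotHolds⇒irrefutable dotHolds-loop ; plusF = plusIrrefutable-loop }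

data Three : Set where
  a b c : Three

data Chain : Three → Three → Set where
  a→b : Chain a b
  b→c : Chain b c

viaChain : ∀ {Pr} → Has Pr (frame Three a noEdge noEdge) →
           ¬ Has Pr (frame Three a Chain noEdge) → Separation Pr
viaChain hasEmpty lacksChain = record
  { S = Three ; pt = a ; A₁ = noEdge ; A₂ = noEdge ; B₁ = Chain
  ; hasF = hasEmpty ; lacksG = lacksChain
  ; dotF = dotHolds⇒irrefutable dotHolds-noEdge
  ; plusF = plusHolds⇒irrefutable plusHolds-noEdge }

separation : ∀ Pr → Separation Pr
separation seriality    = viaLoop ((λ _ → tt , tt) , (λ _ → tt , tt))
                                  (λ (serial , _) → proj₂ (serial tt))
separation reflexivity  = viaLoop ((λ _ → tt) , (λ _ → tt))
                                  (λ (reflexive , _) → reflexive tt)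
separation transitivity = viaChain ((λ _ _ _ ()) , (λ _ _ _ ()))
                                   (λ (transitive , _) → absurd (transitive a b c a→b b→c))
  where absurd : ¬ Chain a c
        absurd ()
separation symmetry     = viaChain ((λ _ _ ()) , (λ _ _ ()))
                                   (λ (symmetric , _) → absurd (symmetric a b a→b))
  where absurd : ¬ Chain b a
        absurd ()
separation euclidicity  = viaChain ((λ _ _ _ ()) , (λ _ _ _ ()))
                                   (λ (euclidean , _) → absurd (euclidean a b b a→b a→b))
  where absurd : ¬ Chain b b
        absurd ()

proposition5p3 : (P : Set) → P → (Pr : FrameProperty) →
    (¬ Σ (Fm⊡ P → Set) (λ Γ → Defines⊡ Pr Γ)) × (¬ Σ (Fm⊞ P → Set) (λ Γ → Defines⊞ Pr Γ))
proposition5p3 P _ Pr = undefinable (separation Pr)
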